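{- The poset of biclosed subsets of the positive roots of $A_\infty$, ordered by containment, is a complete lattice.
   Context: $A_\infty$ is the group of permutations of $\mathbb{Z}$ fixing all but finitely many points, with simple generators $(i,i+1)$. Its positive roots are $\Phi^+=\{\beta_{ij}=e_j-e_i:i<j\}$ in the real vector space with basis $e_i$, $i\in\mathbb{Z}$. A subset $B\subseteq\Phi^+$ is biclosed if for all $\alpha,\beta,\gamma\in\Phi^+$ with $\gamma\in\mathbb{R}_{>0}\alpha+\mathbb{R}_{>0}\beta$: $\alpha,\beta\in B\Rightarrow\gamma\in B$, and $\alpha,\beta\notin B\Rightarrow\gamma\notin B$. -}

module Defs where

open import Level using (Level; 0ℓ; suc; _⊔_)
open import Data.Integer using (ℤ; _<_)
open import Data.Rational using (ℚ; 0ℚ; 1ℚ; -_; _+_; _*_) renaming (_<_ to _<ℚ_)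
open import Data.Product using (Σ; ∃; ∃-syntax; _×_)
open import Relation.Nullary using (¬_; yes; no)
open import Relation.Binary.PropositionalEquality using (_≡_)
open import Data.Integer using (_≟_)

-- A positive root β_ij = e_j - e_i of A_∞, with i < j in ℤ.
record Root : Set where
  constructor root
  field
    i j : ℤ
    i<j : i < j
open Root public

coord : Root → ℤ → ℚ
coord r m with m Data.Integer.≟ j r
... | yes _ = 1ℚ
... | no _ with m Data.Integer.≟ i r
...   | yes _ = - 1ℚ
...   | no _  = 0ℚ

-- γ lies in the open cone ℝ_{>0}α + ℝ_{>0}β (coefficients taken in ℚ).
InOpenCone : Root → Root → Root → Set
InOpenCone γ α β =
  ∃[ a ] ∃[ b ] (0ℚ <ℚ a × 0ℚ <ℚ b × (∀ m → coord γ m ≡ a * coord α m + b * coord β m))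

RootSet : Set₁
RootSet = Root → Set

_⊆_ : RootSet → RootSet → Set
B ⊆ C = ∀ r → B r → C r

IsBiclosed : RootSet → Set
IsBiclosed B =
  ∀ α β γ → InOpenCone γ α β →
    ((B α → B β → B γ) × (¬ B α → ¬ B β → ¬ B γ))

record Biclosed : Set₁ where
  constructor mkBiclosed
  field
    set      : RootSet
    isBiclosed : IsBiclosed set
open Biclosed public

_≤B_ : Biclosed → Biclosed → Set
B ≤B C = set B ⊆ set C

IsLub : {I : Set} → (I → Biclosed) → Biclosed → Set₁
IsLub {I} F U = (∀ k → F k ≤B U) × (∀ (C : Biclosed) → (∀ k → F k ≤B C) → U ≤B C)

IsGlb : {I : Set} → (I → Biclosed) → Biclosed → Set₁
IsGlb {I} F L = (∀ k → L ≤B F k) × (∀ (C : Biclosed) → (∀ k → C ≤B F k) → C ≤B L)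

BiclosedIsCompleteLattice : Set₁
BiclosedIsCompleteLattice =
  ∀ (I : Set) (F : I → Biclosed) →
    (Σ Biclosed λ U → IsLub F U) × (Σ Biclosed λ L → IsGlb F L)

-- A cone relation γ ∈ ℝ>0 α + ℝ>0 β among positive roots of A∞ forces γ = α + β, γ = β + α or
-- α = β = γ, and β_xz = β_xy + β_yz.  Hence biclosed sets are exactly the relations P on ℤ
-- (P x y standing for β_xy ∈ B) that are transitive and coclosed: ¬ P x y and ¬ P y z imply
-- ¬ P x z for x < y < z.  The join of a family is the transitive closure of the union, which
-- stays coclosed.  The meet is the greatest coclosed relation inside the intersection.  As
-- membership is not decidable it is built as ∀ n → Approx n, where Approx (n + 1) x z also asks
-- every y between x and z to split the pair, up to double negation, into Approx n pairs; on an
-- interval of length n the approximations have stabilised, and that makes the limit coclosed.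
module Submission where

open import Defs
open import Level using (0ℓ)
open import Data.Empty using (⊥-elim)
open import Data.Integer using (ℤ; +_; +≤+; 1ℤ; _<_; _≤_; _≟_; ∣_∣; _-_) renaming (_+_ to _+ℤ_; -_ to -ℤ_; suc to sucℤ)
import Data.Integer.Properties as ℤP
open import Data.Nat using (ℕ; zero; suc; _≤′_; ≤′-refl; ≤′-step) renaming (_≤_ to _≤ℕ_)
import Data.Nat.Properties as ℕP
open import Data.Rational using (0ℚ; 1ℚ; -_; _+_; _*_; nonNegative) renaming (_<_ to _<ℚ_; _≤_ to _≤ℚ_)
import Data.Rational.Properties as ℚP
open import Data.Product using (Σ-syntax; ∃; _×_; _,_; proj₁; proj₂)
open import Data.Sum using (_⊎_; inj₁; inj₂; [_,_]′) renaming (map to ⊎-map; map₁ to ⊎-map₁; map₂ to ⊎-map₂)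
open import Function using (_∘_; flip; const)
open import Relation.Binary.Core using (Rel; _⇒_)
open import Relation.Binary.Definitions using (Transitive; tri<; tri≈; tri>)
open import Relation.Binary.Construct.Closure.Transitive using (TransClosure; [_]; _∷_; _++_)
open import Relation.Binary.PropositionalEquality using (_≡_; _≢_; refl; sym; trans; cong; cong₂; subst; ≢-sym; module ≡-Reasoning)
open import Relation.Nullary using (¬_; Dec; yes; no)
open import Relation.Nullary.Negation using (¬¬-map)

coord-head : ∀ r → coord r (j r) ≡ 1ℚ
coord-head r with j r ≟ j r
... | yes _   = refl
... | no j≢j = ⊥-elim (j≢j refl)

coord-tail : ∀ r → coord r (i r) ≡ - 1ℚ
coord-tail r with i r ≟ j r
... | yes i≡j = ⊥-elim (ℤP.<⇒≢ (i<j r) i≡j)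
... | no _ with i r ≟ i r
...   | yes _   = refl
...   | no i≢i = ⊥-elim (i≢i refl)

coord-off : ∀ r {m} → m ≢ j r → m ≢ i r → coord r m ≡ 0ℚ
coord-off r {m} m≢j m≢i with m ≟ j r
... | yes m≡j = ⊥-elim (m≢j m≡j)
... | no _ with m ≟ i r
...   | yes m≡i = ⊥-elim (m≢i m≡i)
...   | no _    = refl

0<1 : 0ℚ <ℚ 1ℚ
0<1 = ℚP.positive⁻¹ 1ℚ

-1<0 : - 1ℚ <ℚ 0ℚ
-1<0 = ℚP.neg-antimono-< 0<1

-- A `with` on `m ≟ j r` also abstracts that test inside `coord r m`, which is defined by it;
-- case analyses on the position of m therefore go through this view.
data CoordCase (r : Root) (m : ℤ) : Set where
  at-head : m ≡ j r → coord r m ≡ 1ℚ → CoordCase r m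
  at-tail : m ≡ i r → coord r m ≡ - 1ℚ → CoordCase r m
  off     : m ≢ j r → m ≢ i r → coord r m ≡ 0ℚ → CoordCase r m

coord-cases : ∀ r m → CoordCase r m
coord-cases r m with m ≟ j r | m ≟ i r
... | yes refl | _        = at-head refl (coord-head r)
... | no _     | yes refl = at-tail refl (coord-tail r)
... | no m≢j   | no m≢i   = off m≢j m≢i (coord-off r m≢j m≢i)

coord-nonneg : ∀ r {m} → m ≢ i r → 0ℚ ≤ℚ coord r m
coord-nonneg r {m} m≢i with coord-cases r m
... | at-head _ c = subst (0ℚ ≤ℚ_) (sym c) (ℚP.<⇒≤ 0<1)
... | at-tail e _ = ⊥-elim (m≢i e)
... | off _ _ c   = subst (0ℚ ≤ℚ_) (sym c) ℚP.≤-refl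

coord-nonpos : ∀ r {m} → m ≢ j r → coord r m ≤ℚ 0ℚ
coord-nonpos r {m} m≢j with coord-cases r m
... | at-head e _ = ⊥-elim (m≢j e)
... | at-tail _ c = subst (_≤ℚ 0ℚ) (sym c) (ℚP.<⇒≤ -1<0)
... | off _ _ c   = subst (_≤ℚ 0ℚ) (sym c) ℚP.≤-refl

coord-pos⇒head : ∀ r {m} → 0ℚ <ℚ coord r m → m ≡ j r
coord-pos⇒head r {m} pos with coord-cases r m
... | at-head e _ = e
... | at-tail _ c = ⊥-elim (ℚP.<-asym -1<0 (subst (0ℚ <ℚ_) c pos))
... | off _ _ c   = ⊥-elim (ℚP.<-irrefl refl (subst (0ℚ <ℚ_) c pos))

coord-neg⇒tail : ∀ r {m} → coord r m <ℚ 0ℚ → m ≡ i r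
coord-neg⇒tail r {m} neg with coord-cases r m
... | at-head _ c = ⊥-elim (ℚP.<-asym 0<1 (subst (_<ℚ 0ℚ) c neg))
... | at-tail e _ = e
... | off _ _ c   = ⊥-elim (ℚP.<-irrefl refl (subst (_<ℚ 0ℚ) c neg))

positive-combination : ∀ {a b c} → 0ℚ <ℚ a → 0ℚ ≤ℚ b → 0ℚ ≤ℚ c → 0ℚ <ℚ a * 1ℚ + b * c
positive-combination {a} {b} {c} 0<a 0≤b 0≤c = begin-strict
  0ℚ             ≡⟨ sym (ℚP.+-identityʳ 0ℚ) ⟩
  0ℚ + 0ℚ        <⟨ ℚP.+-mono-<-≤ 0<a 0≤bc ⟩
  a + b * c      ≡⟨ cong (_+ b * c) (sym (ℚP.*-identityʳ a)) ⟩
  a * 1ℚ + b * c ∎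
  where
  open ℚP.≤-Reasoning
  0≤bc : 0ℚ ≤ℚ b * c
  0≤bc = subst (_≤ℚ b * c) (ℚP.*-zeroʳ b) (ℚP.*-monoˡ-≤-nonNeg b {{nonNegative 0≤b}} 0≤c)

negative-combination : ∀ {a b c} → 0ℚ <ℚ a → 0ℚ ≤ℚ b → c ≤ℚ 0ℚ → a * - 1ℚ + b * c <ℚ 0ℚ
negative-combination {a} {b} {c} 0<a 0≤b c≤0 = begin-strict
  a * - 1ℚ + b * c   ≡⟨ cong (_+ b * c) (sym (ℚP.neg-distribʳ-* a 1ℚ)) ⟩
  - (a * 1ℚ) + b * c ≡⟨ cong (λ u → - u + b * c) (ℚP.*-identityʳ a) ⟩
  - a + b * c        <⟨ ℚP.+-mono-<-≤ (ℚP.neg-antimono-< 0<a) bc≤0 ⟩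
  - 0ℚ + 0ℚ          ≡⟨ ℚP.+-identityʳ 0ℚ ⟩
  0ℚ                 ∎
  where
  open ℚP.≤-Reasoning
  bc≤0 : b * c ≤ℚ 0ℚ
  bc≤0 = subst (b * c ≤ℚ_) (ℚP.*-zeroʳ b) (ℚP.*-monoˡ-≤-nonNeg b {{nonNegative 0≤b}} c≤0)

cone-sym : ∀ {γ α β} → InOpenCone γ α β → InOpenCone γ β α
cone-sym {α = α} {β} (a , b , 0<a , 0<b , eq) =
  b , a , 0<b , 0<a , λ m → trans (eq m) (ℚP.+-comm (a * coord α m) (b * coord β m))

cone-head : ∀ {γ α β} → InOpenCone γ α β → j α ≢ i β → j α ≡ j γ
cone-head {γ} {α} {β} (a , b , 0<a , 0<b , eq) jα≢iβ =
  coord-pos⇒head γ (subst (0ℚ <ℚ_) (sym value) (positive-combination 0<a (ℚP.<⇒≤ 0<b) (coord-nonneg β jα≢iβ)))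
  where
  value : coord γ (j α) ≡ a * 1ℚ + b * coord β (j α)
  value = trans (eq (j α)) (cong (λ u → a * u + b * coord β (j α)) (coord-head α))

cone-tail : ∀ {γ α β} → InOpenCone γ α β → i α ≢ j β → i α ≡ i γ
cone-tail {γ} {α} {β} (a , b , 0<a , 0<b , eq) iα≢jβ =
  coord-neg⇒tail γ (subst (_<ℚ 0ℚ) (sym value) (negative-combination 0<a (ℚP.<⇒≤ 0<b) (coord-nonpos β iα≢jβ)))
  where
  value : coord γ (i α) ≡ a * - 1ℚ + b * coord β (i α)
  value = trans (eq (i α)) (cong (λ u → a * u + b * coord β (i α)) (coord-tail α))

data ConeShape (γ α β : Root) : Set where
  γ≡α+β : i α ≡ i γ → j α ≡ i β → j β ≡ j γ → ConeShape γ α β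
  γ≡β+α : i β ≡ i γ → j β ≡ i α → j α ≡ j γ → ConeShape γ α β
  γ≡α≡β : i α ≡ i γ → j α ≡ j γ → i β ≡ i γ → j β ≡ j γ → ConeShape γ α β

adjacent-ends-distinct : ∀ α β → j α ≡ i β → i α ≢ j β
adjacent-ends-distinct α β jα≡iβ = ℤP.<⇒≢ (ℤP.<-trans (i<j α) (subst (_< j β) (sym jα≡iβ) (i<j β)))

cone-shape : ∀ {γ α β} → InOpenCone γ α β → ConeShape γ α β
cone-shape {γ} {α} {β} c with j α ≟ i β | j β ≟ i α
... | yes jα≡iβ | _ =
  γ≡α+β (cone-tail c iα≢jβ) jα≡iβ (cone-head (cone-sym c) (≢-sym iα≢jβ))
  where
  iα≢jβ : i α ≢ j β
  iα≢jβ = adjacent-ends-distinct α β jα≡iβ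
... | no _ | yes jβ≡iα =
  γ≡β+α (cone-tail (cone-sym c) iβ≢jα) jβ≡iα (cone-head c (≢-sym iβ≢jα))
  where
  iβ≢jα : i β ≢ j α
  iβ≢jα = adjacent-ends-distinct β α jβ≡iα
... | no jα≢iβ | no jβ≢iα =
  γ≡α≡β (cone-tail c (≢-sym jβ≢iα)) (cone-head c jα≢iβ)
        (cone-tail (cone-sym c) (≢-sym jα≢iβ)) (cone-head (cone-sym c) jβ≢iα)

module _ {x y z} (x<y : x < y) (y<z : y < z) (x<z : x < z) where
  private
    γ α β : Root
    γ = root x z x<z
    α = root x y x<y
    β = root y z y<z

    values : ∀ m {u v w} → coord γ m ≡ u → coord α m ≡ v → coord β m ≡ w → u ≡ v + w →
             coord γ m ≡ coord α m + coord β m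
    values m eγ eα eβ e = trans eγ (trans e (sym (cong₂ _+_ eα eβ)))

  triangle-coord : ∀ m → coord γ m ≡ coord α m + coord β m
  triangle-coord m = by-position m (m ≟ z) (m ≟ y) (m ≟ x)
    where
    by-position : ∀ m → Dec (m ≡ z) → Dec (m ≡ y) → Dec (m ≡ x) → coord γ m ≡ coord α m + coord β m
    by-position m (yes refl) _ _ =
      values z (coord-head γ) (coord-off α (≢-sym (ℤP.<⇒≢ y<z)) (≢-sym (ℤP.<⇒≢ x<z))) (coord-head β)
             (sym (ℚP.+-identityˡ 1ℚ))
    by-position m (no m≢z) (yes refl) _ =
      values y (coord-off γ m≢z (≢-sym (ℤP.<⇒≢ x<y))) (coord-head α) (coord-tail β) (sym (ℚP.+-inverseʳ 1ℚ))
    by-position m (no m≢z) (no m≢y) (yes refl) =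
      values x (coord-tail γ) (coord-tail α) (coord-off β m≢z m≢y) (sym (ℚP.+-identityʳ (- 1ℚ)))
    by-position m (no m≢z) (no m≢y) (no m≢x) =
      values m (coord-off γ m≢z m≢x) (coord-off α m≢y m≢x) (coord-off β m≢z m≢y) (sym (ℚP.+-identityˡ 0ℚ))

  triangle-cone : InOpenCone γ α β
  triangle-cone = 1ℚ , 1ℚ , 0<1 , 0<1 , λ m →
    trans (triangle-coord m) (sym (cong₂ _+_ (ℚP.*-identityˡ (coord α m)) (ℚP.*-identityˡ (coord β m))))

Coclosed : Rel ℤ 0ℓ → Set
Coclosed P = ∀ {x y z} → x < y → y < z → ¬ P x y → ¬ P y z → ¬ P x z

rootSet : Rel ℤ 0ℓ → RootSet
rootSet P r = P (i r) (j r)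

isBiclosed-rootSet : ∀ {P} → Transitive P → Coclosed P → IsBiclosed (rootSet P)
isBiclosed-rootSet P-trans P-coclosed (root _ _ p) (root _ _ q) (root _ _ _) c with cone-shape c
... | γ≡α+β refl refl refl      = P-trans , P-coclosed p q
... | γ≡β+α refl refl refl      = flip P-trans , flip (P-coclosed q p)
... | γ≡α≡β refl refl refl refl = const , const

Arc : RootSet → Rel ℤ 0ℓ
Arc B x y = Σ[ x<y ∈ x < y ] B (root x y x<y)

arc⇒∈ : ∀ (B : RootSet) {r} → Arc B (i r) (j r) → B r
arc⇒∈ B (x<y , b) = subst (λ p → B (root _ _ p)) (ℤP.<-irrelevant x<y _) b

arc-mono : ∀ {B C : RootSet} → B ⊆ C → Arc B ⇒ Arc C
arc-mono B⊆C (x<y , b) = x<y , B⊆C _ b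

arc-transitive : ∀ B → Transitive (Arc (set B))
arc-transitive B {x} {_} {z} (x<y , bxy) (y<z , byz) =
  x<z , proj₁ (isBiclosed B _ _ _ (triangle-cone x<y y<z x<z)) bxy byz
  where
  x<z : x < z
  x<z = ℤP.<-trans x<y y<z

arc-coclosed : ∀ B → Coclosed (Arc (set B))
arc-coclosed B x<y y<z ¬xy ¬yz (x<z , bxz) =
  proj₂ (isBiclosed B _ _ _ (triangle-cone x<y y<z x<z)) (λ b → ¬xy (x<y , b)) (λ b → ¬yz (y<z , b)) bxz

module Join {I : Set} (R : I → Rel ℤ 0ℓ) (R-coclosed : ∀ t → Coclosed (R t)) where

  Step : Rel ℤ 0ℓ
  Step x y = ∃ λ t → R t x y

  Chain : Rel ℤ 0ℓ
  Chain = TransClosure Step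

  chain-coclosed : Coclosed Chain
  chain-coclosed x<y y<z ¬xy ¬yz [ t , r ] =
    R-coclosed t x<y y<z (λ r′ → ¬xy [ t , r′ ]) (λ r′ → ¬yz [ t , r′ ]) r
  chain-coclosed {y = y} x<y y<z ¬xy ¬yz (_∷_ {y = w} (t , r) w→z) with ℤP.<-cmp y w
  ... | tri< y<w _ _  = R-coclosed t x<y y<w (λ r′ → ¬xy [ t , r′ ]) (λ r′ → ¬yz ((t , r′) ∷ w→z)) r
  ... | tri≈ _ refl _ = ¬xy [ t , r ]
  ... | tri> _ _ w<y  = chain-coclosed w<y y<z (λ w→y → ¬xy ((t , r) ∷ w→y)) ¬yz w→z

  chain-least : ∀ {Q : Rel ℤ 0ℓ} → Transitive Q → (∀ t → R t ⇒ Q) → Chain ⇒ Q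
  chain-least Q-trans R⊆Q [ t , r ]     = R⊆Q t r
  chain-least Q-trans R⊆Q ((t , r) ∷ c) = Q-trans (R⊆Q t r) (chain-least Q-trans R⊆Q c)

record Within (n : ℕ) (x z : ℤ) : Set where
  constructor within
  field bound : z ≤ + n +ℤ x

within-≤ : ∀ {x z} → x ≤ z → Within ∣ x - z ∣ x z
within-≤ {x} {z} x≤z = within (ℤP.≤-reflexive (sym (begin
  + ∣ x - z ∣ +ℤ x     ≡⟨ cong (_+ℤ x) (ℤP.∣-∣-≤ x≤z) ⟩
  (z - x) +ℤ x         ≡⟨ ℤP.+-assoc z (-ℤ x) x ⟩
  z +ℤ (-ℤ x +ℤ x)     ≡⟨ cong (z +ℤ_) (ℤP.+-inverseˡ x) ⟩
  z +ℤ + 0             ≡⟨ ℤP.+-identityʳ z ⟩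
  z                    ∎)))
  where open ≡-Reasoning

¬within-zero : ∀ {x z} → x < z → ¬ Within 0 x z
¬within-zero {x} x<z (within z≤x) = ℤP.<⇒≱ x<z (subst (_ ≤_) (ℤP.+-identityˡ x) z≤x)

within-mono : ∀ {m n x z} → m ≤ℕ n → Within m x z → Within n x z
within-mono {x = x} m≤n (within z≤m+x) = within (ℤP.≤-trans z≤m+x (ℤP.+-monoˡ-≤ x (+≤+ m≤n)))

within-suc-below : ∀ {n x y z} → y < z → Within (suc n) x z → Within n x y
within-suc-below {n} {x} {y} {z} y<z (within z≤1+n+x) = within
  (subst (y ≤_) (ℤP.pred-suc (+ n +ℤ x))
    (ℤP.i<j⇒i≤pred[j] (ℤP.<-≤-trans y<z (subst (z ≤_) (ℤP.suc-+ n x) z≤1+n+x))))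

within-suc-above : ∀ {n x y z} → x < y → Within (suc n) x z → Within n y z
within-suc-above {n} {x} {y} {z} x<y (within z≤1+n+x) = within
  (ℤP.≤-trans (subst (z ≤_) shift z≤1+n+x) (ℤP.+-monoʳ-≤ (+ n) (ℤP.i<j⇒suc[i]≤j x<y)))
  where
  shift : + suc n +ℤ x ≡ + n +ℤ sucℤ x
  shift = trans (cong (_+ℤ x) (ℤP.+-comm 1ℤ (+ n))) (ℤP.+-assoc (+ n) 1ℤ x)

module Meet {I : Set} (R : I → Rel ℤ 0ℓ) (R-trans : ∀ t → Transitive (R t)) where

  ⋂R : Rel ℤ 0ℓ
  ⋂R x y = ∀ t → R t x y

  Splits : Rel ℤ 0ℓ → Rel ℤ 0ℓ
  Splits P x z = ∀ {y} → x < y → y < z → ¬ ¬ (P x y ⊎ P y z)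

  Approx : ℕ → Rel ℤ 0ℓ
  Approx zero    x z = ⋂R x z
  Approx (suc n) x z = ⋂R x z × Splits (Approx n) x z

  Meet : Rel ℤ 0ℓ
  Meet x z = ∀ n → Approx n x z

  approx-suc⇒approx : ∀ n → Approx (suc n) ⇒ Approx n
  approx-suc⇒approx zero    = proj₁
  approx-suc⇒approx (suc n) (k , s) =
    k , λ x<y y<z → ¬¬-map (⊎-map (approx-suc⇒approx n) (approx-suc⇒approx n)) (s x<y y<z)

  approx-antitone : ∀ {m n} → m ≤′ n → Approx n ⇒ Approx m
  approx-antitone              ≤′-refl       = λ a → a
  approx-antitone {n = suc n} (≤′-step m≤n) = approx-antitone m≤n ∘ approx-suc⇒approx n

  ⋂R-transitive : Transitive ⋂R
  ⋂R-transitive a b t = R-trans t (a t) (b t)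

  approx-transitive : ∀ n → Transitive (Approx n)
  approx-transitive zero = ⋂R-transitive
  approx-transitive (suc n) {x} {y} {z} a₁@(k₁ , s₁) a₂@(k₂ , s₂) = ⋂R-transitive k₁ k₂ , splits
    where
    splits : Splits (Approx n) x z
    splits {w} x<w w<z with ℤP.<-cmp w y
    ... | tri< w<y _ _  = ¬¬-map (⊎-map₂ (λ a → approx-transitive n a (approx-suc⇒approx n a₂))) (s₁ x<w w<y)
    ... | tri≈ _ refl _ = λ ¬split → ¬split (inj₁ (approx-suc⇒approx n a₁))
    ... | tri> _ _ y<w  = ¬¬-map (⊎-map₁ (approx-transitive n (approx-suc⇒approx n a₁))) (s₂ y<w w<z)

  approx-stable : ∀ n {x z} → x < z → Within n x z → Approx n x z → Approx (suc n) x z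
  approx-stable zero    x<z bound _ = ⊥-elim (¬within-zero x<z bound)
  approx-stable (suc n) x<z bound (k , s) = k , λ x<y y<z →
    ¬¬-map (⊎-map (approx-stable n x<y (within-suc-below y<z bound))
                  (approx-stable n y<z (within-suc-above x<y bound)))
           (s x<y y<z)

  approx-upward : ∀ {m n x z} → n ≤′ m → x < z → Within n x z → Approx n x z → Approx m x z
  approx-upward         ≤′-refl       x<z bound a = a
  approx-upward {suc m} (≤′-step n≤m) x<z bound a =
    approx-stable m x<z (within-mono (ℕP.≤′⇒≤ n≤m) bound) (approx-upward n≤m x<z bound a)

  approx⇒meet : ∀ {n x z} → x < z → Within n x z → Approx n x z → Meet x z
  approx⇒meet {n} x<z bound a m =
    approx-antitone (ℕP.≤⇒≤′ (ℕP.m≤m+n m n))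
      (approx-upward (ℕP.≤⇒≤′ (ℕP.m≤n+m n m)) x<z bound a)

  meet-transitive : Transitive Meet
  meet-transitive a b n = approx-transitive n (a n) (b n)

  meet-coclosed : Coclosed Meet
  meet-coclosed {x} {y} {z} x<y y<z ¬xy ¬yz m =
    proj₂ (m (suc n)) x<y y<z [ ¬xy ∘ approx⇒meet x<y (within-suc-below y<z bound)
                              , ¬yz ∘ approx⇒meet y<z (within-suc-above x<y bound) ]′
    where
    n : ℕ
    n = ∣ x - z ∣
    bound : Within (suc n) x z
    bound = within-mono (ℕP.n≤1+n n) (within-≤ (ℤP.<⇒≤ (ℤP.<-trans x<y y<z)))

  meet⊆ : ∀ t → Meet ⇒ R t
  meet⊆ t m = m zero t

  meet-greatest : ∀ {Q : Rel ℤ 0ℓ} → Coclosed Q → Q ⇒ ⋂R → Q ⇒ Meet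
  meet-greatest {Q} Q-coclosed Q⊆⋂R q n = below n q
    where
    below : ∀ n → Q ⇒ Approx n
    below zero    = Q⊆⋂R
    below (suc n) q = Q⊆⋂R q , λ x<y y<z ¬split →
      Q-coclosed x<y y<z (¬split ∘ inj₁ ∘ below n) (¬split ∘ inj₂ ∘ below n) q

module _ {I : Set} (F : I → Biclosed) where
  open Join (λ t → Arc (set (F t))) (λ t → arc-coclosed (F t))
  open Meet (λ t → Arc (set (F t))) (λ t → arc-transitive (F t))

  join : Biclosed
  join = mkBiclosed (rootSet Chain) (isBiclosed-rootSet _++_ chain-coclosed)

  join-isLub : IsLub F join
  join-isLub = (λ t r b → [ t , i<j r , b ])
             , λ C F≤C r c → arc⇒∈ (set C) (chain-least (arc-transitive C) (λ t → arc-mono (F≤C t)) c)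

  meet : Biclosed
  meet = mkBiclosed (rootSet Meet) (isBiclosed-rootSet meet-transitive meet-coclosed)

  meet-isGlb : IsGlb F meet
  meet-isGlb = (λ t r m → arc⇒∈ (set (F t)) (meet⊆ t m))
             , λ C C≤F r c → meet-greatest (arc-coclosed C) (λ a t → arc-mono (C≤F t) a) (i<j r , c)

theorem5p3 : BiclosedIsCompleteLattice
theorem5p3 I F = (join F , join-isLub F) , (meet F , meet-isGlb F)
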